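{- Let $k$ and $m$ be positive integers and let $|q|<1$. Define the coefficients $C'(k,m,n)$ by \[ \sum_{n\geq 0}C'(k,m,n) q^n = \sum_{n\geq 0} q^{m(2n+1)} \frac{(q^{2n+2},q^{2n+2k};q^2)_\infty}{(q^{2n+1};q^2)_\infty^2}. \] Then \[ \sum_{n\geq 0}C'(k,m,n) q^n =\begin{cases} \dfrac{q^m}{(q;q^2)_{k-1}} \displaystyle \sum_{n\geq 0}\frac{q^n (q^{2n+2};q^2)_{m-1}}{(q^{2n+2k-1};q^2)_{m-k+1}} & \text{if } m\geq k, \\[3mm] \dfrac{q^m}{(q;q^2)_{k-1}} \displaystyle \sum_{n\geq 0} q^n (q^{2n+2};q^2)_{m-1}(q^{2n+2m+1};q^2)_{k-m-1} & \text{if } m<k. \end{cases} \]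
   Context: For a complex number $a$ and $|q|<1$: $(a;q)_0=1$, $(a;q)_n=\prod_{j=0}^{n-1}(1-aq^j)$, $(a;q)_\infty=\prod_{j\geq 0}(1-aq^j)$, and $(a_1,\dots,a_r;q)_n=\prod_{j=1}^r(a_j;q)_n$, $(a_1,\dots,a_r;q)_\infty=\prod_{j=1}^r(a_j;q)_\infty$. -}

module Defs where

open import Data.Nat using (ℕ; zero; suc; _+_; _*_; _∸_; _≤_; _<_)
open import Data.Nat.Divisibility using (_∣?_)
open import Data.Integer as ℤ using (ℤ; +_; -_)
open import Data.Fin using (Fin; toℕ)
open import Data.Vec using (Vec; _∷_; []; head; lookup)
open import Relation.Nullary.Decidable using (does)
open import Data.Bool using (if_then_else_)

-- Formal power series in q with integer coefficients: n ↦ coefficient of q^n.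
PS : Set
PS = ℕ → ℤ

sumTo : (ℕ → ℤ) → ℕ → ℤ
sumTo h zero    = h 0
sumTo h (suc N) = sumTo h N ℤ.+ h (suc N)

sumFin : (n : ℕ) → (Fin n → ℤ) → ℤ
sumFin zero    h = + 0
sumFin (suc n) h = h Data.Fin.zero ℤ.+ sumFin n (λ i → h (Data.Fin.suc i))

𝟙 : PS
𝟙 zero    = + 1
𝟙 (suc _) = + 0

qpow : ℕ → PS
qpow d n = if does (d Data.Nat.≟ n) then + 1 else + 0

_⊕_ : PS → PS → PS
(f ⊕ g) n = f n ℤ.+ g n

_⊖_ : PS → PS → PS
(f ⊖ g) n = f n ℤ.- g n

_⊛_ : PS → PS → PS
(f ⊛ g) N = sumTo (λ i → f i ℤ.* g (N ∸ i)) N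

infixl 6 _⊕_ _⊖_
infixl 7 _⊛_

-- multiplicative inverse of a power series with constant term 1:
-- g_0 = 1, g_{N+1} = - Σ_{i=1}^{N+1} f_i g_{N+1-i}.
-- invVec f N = [g_N, g_{N-1}, …, g_0]
invVec : PS → (N : ℕ) → Vec ℤ (suc N)
invVec f zero    = + 1 ∷ []
invVec f (suc N) =
  (- sumFin (suc N) (λ j → f (suc (toℕ j)) ℤ.* lookup v j)) ∷ v
  where v = invVec f N

inv : PS → PS
inv f N = head (invVec f N)

-- finite q-Pochhammer symbol (q^a;q^b)_n = ∏_{j<n} (1 - q^{a+bj})
poch : ℕ → ℕ → ℕ → PS
poch a b zero    = 𝟙
poch a b (suc n) = poch a b n ⊛ (𝟙 ⊖ qpow (a + b * n))

-- infinite q-Pochhammer symbol (q^a;q^b)_∞ for a ≥ 1, b ≥ 1: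
-- its coefficient of q^N agrees with that of the finite product with N+1
-- factors (all further factors are 1 + O(q^{N+1})).
pochInf : ℕ → ℕ → PS
pochInf a b N = poch a b (suc N) N

-- Infinite sum Σ_{n≥0} T n of power series where T n = O(q^n):
-- the coefficient of q^N only receives contributions from n ≤ N.
sumInf : (ℕ → PS) → PS
sumInf T N = sumTo (λ n → T n N) N

-- C'(k,m,n): coefficients of
--   Σ_{n≥0} q^{m(2n+1)} (q^{2n+2}, q^{2n+2k}; q^2)_∞ / (q^{2n+1}; q^2)_∞^2
-- (for m ≥ 1 the n-th summand is O(q^{2n+1}), so sumInf applies)
LHS : ℕ → ℕ → PS
LHS k m = sumInf λ n →
  qpow (m * (2 * n + 1)) ⊛ pochInf (2 * n + 2) 2 ⊛ pochInf (2 * n + 2 * k) 2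
    ⊛ inv (pochInf (2 * n + 1) 2) ⊛ inv (pochInf (2 * n + 1) 2)

C′ : ℕ → ℕ → ℕ → ℤ
C′ k m n = LHS k m n

RHS≥ : ℕ → ℕ → PS
RHS≥ k m = qpow m ⊛ inv (poch 1 2 (k ∸ 1)) ⊛ sumInf (λ n →
  qpow n ⊛ poch (2 * n + 2) 2 (m ∸ 1) ⊛ inv (poch (2 * n + 2 * k ∸ 1) 2 (m ∸ k + 1)))

RHS< : ℕ → ℕ → PS
RHS< k m = qpow m ⊛ inv (poch 1 2 (k ∸ 1)) ⊛ sumInf (λ n →
  qpow n ⊛ poch (2 * n + 2) 2 (m ∸ 1) ⊛ poch (2 * n + 2 * m + 1) 2 (k ∸ m ∸ 1))

-- Write E(x) = (q^x;q²)_∞ and ρ = E(2)/E(1). The engine is the q-binomial theorem in base q²,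
--   Σ_j (q^a;q²)_j / (q²;q²)_j · q^{sj} = E(a+s) / E(s)      (s ≥ 1),
-- proved by checking that the left side times E(s) and E(a+s) both satisfy
-- Y(s) = (1 - q^{a+s}) Y(s+2) and agree with 1 below degree s: such a recursion raises the order of
-- agreement by 2 at every step, so it has only one solution.
--
-- In the n-th summand of the left-hand side, E(2n+2)/E(2n+1) = ρ (q;q²)_n/(q²;q²)_n, and
-- E(2n+2k)/E(2n+1) is the q-binomial series with a = 2k-1 and s = 2n+1. After exchanging the two
-- summations, the sum over n is again a q-binomial series, now with a = 1 and s = 2(m+j); it equals
-- E(2m+2j+1)/E(2m+2j), which cancels ρ against finite products. The j-th term becomes
--   (q^{2k-1};q²)_j q^{m+j} (q²;q²)_{m+j-1} / ((q²;q²)_j (q;q²)_{m+j}),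
-- and splitting these finite products at k-1, according to whether m ≥ k or m < k, gives the two
-- right-hand sides.

module Submission where

open import Defs
open import Data.Nat as ℕ using (ℕ; zero; suc; _+_; _*_; _∸_; _≤_; _<_; z≤n; s≤s; _<?_)
import Data.Nat.Properties as ℕP
open import Data.Integer as ℤ using (ℤ; +_; -_)
import Data.Integer.Properties as ℤP
open import Data.Integer.Tactic.RingSolver using (solve-∀)
import Data.Nat.Tactic.RingSolver as ℕS
open import Data.Product using (_×_; _,_)
open import Data.Sum using (inj₁; inj₂)
open import Data.Fin as Fin using (Fin; toℕ)
open import Data.Vec using (lookup)
open import Function using (_∘_)
open import Level using (0ℓ)
open import Algebra.Bundles using (CommutativeMonoid)
import Algebra.Solver.CommutativeMonoid as CommutativeMonoidSolver
open import Relation.Binary.PropositionalEquality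
open import Relation.Nullary using (yes; no)
open import Relation.Binary.Bundles using (Setoid)
import Relation.Binary.Reasoning.Setoid

sumTo-cong : ∀ {h h′ : ℕ → ℤ} N → (∀ i → i ≤ N → h i ≡ h′ i) → sumTo h N ≡ sumTo h′ N
sumTo-cong zero    e = e 0 z≤n
sumTo-cong (suc N) e =
  cong₂ ℤ._+_ (sumTo-cong N (λ i i≤N → e i (ℕP.m≤n⇒m≤1+n i≤N))) (e (suc N) ℕP.≤-refl)

sumTo-unfoldˡ : ∀ (h : ℕ → ℤ) N → sumTo h (suc N) ≡ h 0 ℤ.+ sumTo (h ∘ suc) N
sumTo-unfoldˡ h zero    = refl
sumTo-unfoldˡ h (suc N) rewrite sumTo-unfoldˡ h N = ℤP.+-assoc (h 0) _ _

sumTo-+ : ∀ (h h′ : ℕ → ℤ) N → sumTo (λ i → h i ℤ.+ h′ i) N ≡ sumTo h N ℤ.+ sumTo h′ N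
sumTo-+ h h′ zero    = refl
sumTo-+ h h′ (suc N) rewrite sumTo-+ h h′ N = interchange (sumTo h N) (sumTo h′ N) (h (suc N)) (h′ (suc N))
  where
  interchange : ∀ a b c d → (a ℤ.+ b) ℤ.+ (c ℤ.+ d) ≡ (a ℤ.+ c) ℤ.+ (b ℤ.+ d)
  interchange = solve-∀

sumTo-*ˡ : ∀ c (h : ℕ → ℤ) N → sumTo (λ i → c ℤ.* h i) N ≡ c ℤ.* sumTo h N
sumTo-*ˡ c h zero    = refl
sumTo-*ˡ c h (suc N) rewrite sumTo-*ˡ c h N = sym (ℤP.*-distribˡ-+ c (sumTo h N) (h (suc N)))

sumTo-neg : ∀ (h : ℕ → ℤ) N → sumTo (λ i → - h i) N ≡ - sumTo h N
sumTo-neg h zero    = refl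
sumTo-neg h (suc N) rewrite sumTo-neg h N = sym (ℤP.neg-distrib-+ (sumTo h N) (h (suc N)))

sumTo-zero : ∀ (h : ℕ → ℤ) N → (∀ i → i ≤ N → h i ≡ + 0) → sumTo h N ≡ + 0
sumTo-zero h zero    e = e 0 z≤n
sumTo-zero h (suc N) e
  rewrite sumTo-zero h N (λ i i≤N → e i (ℕP.m≤n⇒m≤1+n i≤N)) | e (suc N) ℕP.≤-refl = refl

sumTo-reverse : ∀ (h : ℕ → ℤ) N → sumTo h N ≡ sumTo (λ i → h (N ∸ i)) N
sumTo-reverse h zero    = refl
sumTo-reverse h (suc N) = begin
  sumTo h N ℤ.+ h (suc N)                 ≡⟨ cong (ℤ._+ h (suc N)) (sumTo-reverse h N) ⟩
  sumTo (λ i → h (N ∸ i)) N ℤ.+ h (suc N) ≡⟨ ℤP.+-comm _ (h (suc N)) ⟩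
  h (suc N) ℤ.+ sumTo (λ i → h (N ∸ i)) N ≡⟨ sumTo-unfoldˡ (λ i → h (suc N ∸ i)) N ⟨
  sumTo (λ i → h (suc N ∸ i)) (suc N)     ∎
  where open ≡-Reasoning

sumTo-comm : ∀ (A : ℕ → ℕ → ℤ) N M →
  sumTo (λ i → sumTo (A i) M) N ≡ sumTo (λ j → sumTo (λ i → A i j) N) M
sumTo-comm A zero    M = refl
sumTo-comm A (suc N) M rewrite sumTo-comm A N M = sym (sumTo-+ (λ j → sumTo (λ i → A i j) N) (A (suc N)) M)

sumTo-extend : ∀ (h : ℕ → ℤ) {N} M → (∀ n → N < n → h n ≡ + 0) → N ≤ M → sumTo h M ≡ sumTo h N
sumTo-extend h zero    vanish z≤n = refl
sumTo-extend h (suc M) vanish N≤1+M with ℕP.m≤n⇒m<n∨m≡n N≤1+M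
... | inj₂ refl        = refl
... | inj₁ (s≤s N≤M)
  rewrite sumTo-extend h M vanish N≤M | vanish (suc M) (s≤s N≤M) = ℤP.+-identityʳ _

tail : PS → PS
tail f n = f (suc n)

_·_ : ℤ → PS → PS
(c · f) n = c ℤ.* f n

neg : PS → PS
neg f n = - f n

𝟘 : PS
𝟘 _ = + 0

⊛-suc : ∀ f g N → (f ⊛ g) (suc N) ≡ f 0 ℤ.* g (suc N) ℤ.+ (tail f ⊛ g) N
⊛-suc f g N = sumTo-unfoldˡ (λ i → f i ℤ.* g (suc N ∸ i)) N

⊛-cong : ∀ {f f′ g g′} → f ≗ f′ → g ≗ g′ → f ⊛ g ≗ f′ ⊛ g′
⊛-cong e e′ N = sumTo-cong N (λ i _ → cong₂ ℤ._*_ (e i) (e′ (N ∸ i)))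

⊛-congˡ : ∀ {f f′} g → f ≗ f′ → f ⊛ g ≗ f′ ⊛ g
⊛-congˡ {f} {f′} g e = ⊛-cong {f} {f′} {g} {g} e (λ _ → refl)

⊛-congʳ : ∀ f {g g′} → g ≗ g′ → f ⊛ g ≗ f ⊛ g′
⊛-congʳ f {g} {g′} = ⊛-cong {f} {f} {g} {g′} (λ _ → refl)

⊛-comm : ∀ f g → f ⊛ g ≗ g ⊛ f
⊛-comm f g N = trans (sumTo-reverse (λ i → f i ℤ.* g (N ∸ i)) N) (sumTo-cong N λ i i≤N →
  trans (cong (λ x → f (N ∸ i) ℤ.* g x) (ℕP.m∸[m∸n]≡n i≤N)) (ℤP.*-comm (f (N ∸ i)) (g i)))

⊛-distribˡ-⊕ : ∀ f g h → f ⊛ (g ⊕ h) ≗ f ⊛ g ⊕ f ⊛ h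
⊛-distribˡ-⊕ f g h N =
  trans (sumTo-cong N (λ i _ → ℤP.*-distribˡ-+ (f i) (g (N ∸ i)) (h (N ∸ i))))
        (sumTo-+ (λ i → f i ℤ.* g (N ∸ i)) (λ i → f i ℤ.* h (N ∸ i)) N)

⊛-distribʳ-⊕ : ∀ f g h → (g ⊕ h) ⊛ f ≗ g ⊛ f ⊕ h ⊛ f
⊛-distribʳ-⊕ f g h N = trans (⊛-comm (g ⊕ h) f N)
  (trans (⊛-distribˡ-⊕ f g h N) (cong₂ ℤ._+_ (⊛-comm f g N) (⊛-comm f h N)))

·-⊛ : ∀ c f g → (c · f) ⊛ g ≗ c · (f ⊛ g)
·-⊛ c f g N = trans (sumTo-cong N (λ i _ → ℤP.*-assoc c (f i) (g (N ∸ i))))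
  (sumTo-*ˡ c (λ i → f i ℤ.* g (N ∸ i)) N)

⊛-neg : ∀ f g → f ⊛ neg g ≗ neg (f ⊛ g)
⊛-neg f g N = trans (sumTo-cong N (λ i _ → sym (ℤP.neg-distribʳ-* (f i) (g (N ∸ i)))))
  (sumTo-neg (λ i → f i ℤ.* g (N ∸ i)) N)

tail-⊛ : ∀ f g → tail (f ⊛ g) ≗ f 0 · tail g ⊕ tail f ⊛ g
tail-⊛ = ⊛-suc

⊛-assoc : ∀ f g h → (f ⊛ g) ⊛ h ≗ f ⊛ (g ⊛ h)
⊛-assoc f g h zero    = ℤP.*-assoc (f 0) (g 0) (h 0)
⊛-assoc f g h (suc N) = begin
  ((f ⊛ g) ⊛ h) (suc N)
    ≡⟨ ⊛-suc (f ⊛ g) h N ⟩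
  f₀ ℤ.* g₀ ℤ.* hₙ ℤ.+ (tail (f ⊛ g) ⊛ h) N
    ≡⟨ cong (λ x → f₀ ℤ.* g₀ ℤ.* hₙ ℤ.+ x) (trans (⊛-congˡ h (tail-⊛ f g) N)
         (trans (⊛-distribʳ-⊕ h (f₀ · tail g) (tail f ⊛ g) N)
                (cong₂ ℤ._+_ (·-⊛ f₀ (tail g) h N) (⊛-assoc (tail f) g h N)))) ⟩
  f₀ ℤ.* g₀ ℤ.* hₙ ℤ.+ (f₀ ℤ.* (tail g ⊛ h) N ℤ.+ (tail f ⊛ (g ⊛ h)) N)
    ≡⟨ regroup f₀ g₀ hₙ _ _ ⟩
  f₀ ℤ.* (g₀ ℤ.* hₙ ℤ.+ (tail g ⊛ h) N) ℤ.+ (tail f ⊛ (g ⊛ h)) N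
    ≡⟨ cong (λ x → f₀ ℤ.* x ℤ.+ (tail f ⊛ (g ⊛ h)) N) (⊛-suc g h N) ⟨
  f₀ ℤ.* (g ⊛ h) (suc N) ℤ.+ (tail f ⊛ (g ⊛ h)) N
    ≡⟨ ⊛-suc f (g ⊛ h) N ⟨
  (f ⊛ (g ⊛ h)) (suc N) ∎
  where
  open ≡-Reasoning
  f₀ = f 0
  g₀ = g 0
  hₙ = h (suc N)
  regroup : ∀ a b c d e → a ℤ.* b ℤ.* c ℤ.+ (a ℤ.* d ℤ.+ e) ≡ a ℤ.* (b ℤ.* c ℤ.+ d) ℤ.+ e
  regroup = solve-∀

⊛-identityˡ : ∀ f → 𝟙 ⊛ f ≗ f
⊛-identityˡ f zero    = ℤP.*-identityˡ (f 0)
⊛-identityˡ f (suc N) = begin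
  (𝟙 ⊛ f) (suc N)                      ≡⟨ ⊛-suc 𝟙 f N ⟩
  + 1 ℤ.* f (suc N) ℤ.+ (tail 𝟙 ⊛ f) N ≡⟨ cong₂ ℤ._+_ (ℤP.*-identityˡ (f (suc N)))
                                            (sumTo-zero _ N (λ i _ → ℤP.*-zeroˡ (f (N ∸ i)))) ⟩
  f (suc N) ℤ.+ + 0                    ≡⟨ ℤP.+-identityʳ _ ⟩
  f (suc N)                            ∎
  where open ≡-Reasoning

⊛-identityʳ : ∀ f → f ⊛ 𝟙 ≗ f
⊛-identityʳ f N = trans (⊛-comm f 𝟙 N) (⊛-identityˡ f N)

⊛-commutativeMonoid : CommutativeMonoid 0ℓ 0ℓ
⊛-commutativeMonoid = record
  { Carrier = PS ; _≈_ = _≗_ ; _∙_ = _⊛_ ; ε = 𝟙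
  ; isCommutativeMonoid = record
    { isMonoid = record
      { isSemigroup = record
        { isMagma = record
          { isEquivalence = Setoid.isEquivalence (ℕ →-setoid ℤ)
          ; ∙-cong = ⊛-cong }
        ; assoc = ⊛-assoc }
      ; identity = ⊛-identityˡ , ⊛-identityʳ }
    ; comm = ⊛-comm } }

open CommutativeMonoidSolver ⊛-commutativeMonoid using (solve; _⊜_) renaming (_⊕_ to _⊗_)
open Setoid (ℕ →-setoid ℤ) using () renaming (sym to ≗-sym; trans to ≗-trans)
module ≗-Reasoning = Relation.Binary.Reasoning.Setoid (ℕ →-setoid ℤ)

⊛-interchange : ∀ a b c d → (a ⊛ b) ⊛ (c ⊛ d) ≗ (a ⊛ c) ⊛ (b ⊛ d)
⊛-interchange = solve 4 (λ a b c d → (a ⊗ b) ⊗ (c ⊗ d) ⊜ (a ⊗ c) ⊗ (b ⊗ d)) (λ _ → refl)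

⊛-left-comm : ∀ a b c → a ⊛ (b ⊛ c) ≗ b ⊛ (a ⊛ c)
⊛-left-comm = solve 3 (λ a b c → a ⊗ (b ⊗ c) ⊜ b ⊗ (a ⊗ c)) (λ _ → refl)

Normalised : PS → Set
Normalised f = f 0 ≡ + 1

⊛-normalised : ∀ f g → Normalised f → Normalised g → Normalised (f ⊛ g)
⊛-normalised f g f₀≡1 g₀≡1 rewrite f₀≡1 | g₀≡1 = refl

lookup-invVec : ∀ f N (j : Fin (suc N)) → lookup (invVec f N) j ≡ inv f (N ∸ toℕ j)
lookup-invVec f zero    Fin.zero    = refl
lookup-invVec f (suc N) Fin.zero    = refl
lookup-invVec f (suc N) (Fin.suc j) = lookup-invVec f N j

sumFin-cong : ∀ n {h h′ : Fin n → ℤ} → (∀ j → h j ≡ h′ j) → sumFin n h ≡ sumFin n h′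
sumFin-cong zero    e = refl
sumFin-cong (suc n) e = cong₂ ℤ._+_ (e Fin.zero) (sumFin-cong n (e ∘ Fin.suc))

sumFin-toℕ : ∀ N (h : ℕ → ℤ) → sumFin (suc N) (h ∘ toℕ) ≡ sumTo h N
sumFin-toℕ zero    h = ℤP.+-identityʳ (h 0)
sumFin-toℕ (suc N) h =
  trans (cong (ℤ._+_ (h 0)) (sumFin-toℕ N (h ∘ suc))) (sym (sumTo-unfoldˡ h N))

inv-suc : ∀ f N → inv f (suc N) ≡ - sumTo (λ i → f (suc i) ℤ.* inv f (N ∸ i)) N
inv-suc f N = cong -_ (trans
  (sumFin-cong (suc N) (λ j → cong (f (suc (toℕ j)) ℤ.*_) (lookup-invVec f N j)))
  (sumFin-toℕ N (λ i → f (suc i) ℤ.* inv f (N ∸ i))))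

⊛-inverseʳ : ∀ f → Normalised f → f ⊛ inv f ≗ 𝟙
⊛-inverseʳ f f₀≡1 zero rewrite f₀≡1 = refl
⊛-inverseʳ f f₀≡1 (suc N) = begin
  (f ⊛ inv f) (suc N)                          ≡⟨ ⊛-suc f (inv f) N ⟩
  f 0 ℤ.* inv f (suc N) ℤ.+ (tail f ⊛ inv f) N ≡⟨ cong (λ c → c ℤ.* inv f (suc N) ℤ.+ S) f₀≡1 ⟩
  + 1 ℤ.* inv f (suc N) ℤ.+ S                  ≡⟨ cong (ℤ._+ S) (trans (ℤP.*-identityˡ _) (inv-suc f N)) ⟩
  - S ℤ.+ S                                    ≡⟨ ℤP.+-inverseˡ S ⟩
  + 0                                          ∎
  where
  open ≡-Reasoning
  S = sumTo (λ i → f (suc i) ℤ.* inv f (N ∸ i)) N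

⊛-inverseˡ : ∀ f → Normalised f → inv f ⊛ f ≗ 𝟙
⊛-inverseˡ f f₀≡1 N = trans (⊛-comm (inv f) f N) (⊛-inverseʳ f f₀≡1 N)

inv-unique : ∀ f g → Normalised f → f ⊛ g ≗ 𝟙 → g ≗ inv f
inv-unique f g f₀≡1 fg≗1 = begin
  g               ≈⟨ ⊛-identityˡ g ⟨
  𝟙 ⊛ g           ≈⟨ ⊛-congˡ g (⊛-inverseˡ f f₀≡1) ⟨
  (inv f ⊛ f) ⊛ g ≈⟨ ⊛-assoc (inv f) f g ⟩
  inv f ⊛ (f ⊛ g) ≈⟨ ⊛-congʳ (inv f) fg≗1 ⟩
  inv f ⊛ 𝟙       ≈⟨ ⊛-identityʳ (inv f) ⟩
  inv f           ∎
  where open ≗-Reasoning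

inv-cong : ∀ {f g} → f ≗ g → Normalised g → inv f ≗ inv g
inv-cong {f} {g} f≗g g₀≡1 = inv-unique g (inv f) g₀≡1
  (≗-trans (⊛-congˡ (inv f) (≗-sym f≗g)) (⊛-inverseʳ f (trans (f≗g 0) g₀≡1)))

inv-⊛ : ∀ f g → Normalised f → Normalised g → inv (f ⊛ g) ≗ inv f ⊛ inv g
inv-⊛ f g f₀≡1 g₀≡1 =
  ≗-sym (inv-unique (f ⊛ g) (inv f ⊛ inv g) (⊛-normalised f g f₀≡1 g₀≡1) (begin
  (f ⊛ g) ⊛ (inv f ⊛ inv g) ≈⟨ ⊛-interchange f g (inv f) (inv g) ⟩
  (f ⊛ inv f) ⊛ (g ⊛ inv g) ≈⟨ ⊛-cong (⊛-inverseʳ f f₀≡1) (⊛-inverseʳ g g₀≡1) ⟩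
  𝟙 ⊛ 𝟙                     ≈⟨ ⊛-identityˡ 𝟙 ⟩
  𝟙                         ∎))
  where open ≗-Reasoning

inv-𝟙 : inv 𝟙 ≗ 𝟙
inv-𝟙 = ≗-sym (inv-unique 𝟙 𝟙 refl (⊛-identityˡ 𝟙))

⊛≗⇒≗⊛-inv : ∀ {x f y} → Normalised f → x ⊛ f ≗ y → x ≗ y ⊛ inv f
⊛≗⇒≗⊛-inv {x} {f} {y} f₀≡1 xf≗y = begin
  x               ≈⟨ ⊛-identityʳ x ⟨
  x ⊛ 𝟙           ≈⟨ ⊛-congʳ x (⊛-inverseʳ f f₀≡1) ⟨
  x ⊛ (f ⊛ inv f) ≈⟨ ⊛-assoc x f (inv f) ⟨
  (x ⊛ f) ⊛ inv f ≈⟨ ⊛-congˡ (inv f) xf≗y ⟩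
  y ⊛ inv f       ∎
  where open ≗-Reasoning

cross-multiply : ∀ a b f g → Normalised f → Normalised g →
  a ⊛ g ≗ b ⊛ f → a ⊛ inv f ≗ b ⊛ inv g
cross-multiply a b f g f₀≡1 g₀≡1 ag≗bf = ⊛≗⇒≗⊛-inv g₀≡1 (begin
  (a ⊛ inv f) ⊛ g ≈⟨ swap a (inv f) g ⟩
  (a ⊛ g) ⊛ inv f ≈⟨ ⊛-congˡ (inv f) ag≗bf ⟩
  (b ⊛ f) ⊛ inv f ≈⟨ ⊛-assoc b f (inv f) ⟩
  b ⊛ (f ⊛ inv f) ≈⟨ ⊛-congʳ b (⊛-inverseʳ f f₀≡1) ⟩
  b ⊛ 𝟙           ≈⟨ ⊛-identityʳ b ⟩
  b               ∎)
  where
  open ≗-Reasoning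
  swap : ∀ x y z → (x ⊛ y) ⊛ z ≗ (x ⊛ z) ⊛ y
  swap = solve 3 (λ x y z → (x ⊗ y) ⊗ z ⊜ (x ⊗ z) ⊗ y) (λ _ → refl)

fraction-⊛ : ∀ p x r y → Normalised r → Normalised y →
  (p ⊛ x) ⊛ inv (r ⊛ y) ≗ (p ⊛ inv r) ⊛ (x ⊛ inv y)
fraction-⊛ p x r y r₀≡1 y₀≡1 = ≗-trans (⊛-congʳ (p ⊛ x) (inv-⊛ r y r₀≡1 y₀≡1))
  (⊛-interchange p x (inv r) (inv y))

fraction-cancelˡ : ∀ c x d → Normalised c → Normalised d → (c ⊛ x) ⊛ inv (c ⊛ d) ≗ x ⊛ inv d
fraction-cancelˡ c x d c₀≡1 d₀≡1 = begin
  (c ⊛ x) ⊛ inv (c ⊛ d)     ≈⟨ fraction-⊛ c x c d c₀≡1 d₀≡1 ⟩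
  (c ⊛ inv c) ⊛ (x ⊛ inv d) ≈⟨ ⊛-congˡ (x ⊛ inv d) (⊛-inverseʳ c c₀≡1) ⟩
  𝟙 ⊛ (x ⊛ inv d)           ≈⟨ ⊛-identityˡ (x ⊛ inv d) ⟩
  x ⊛ inv d                 ∎
  where open ≗-Reasoning

fraction-reciprocal : ∀ u b c → Normalised b → Normalised c → (u ⊛ (b ⊛ inv c)) ⊛ (c ⊛ inv b) ≗ u
fraction-reciprocal u b c b₀≡1 c₀≡1 = begin
  (u ⊛ (b ⊛ inv c)) ⊛ (c ⊛ inv b) ≈⟨ regroup u b (inv c) c (inv b) ⟩
  u ⊛ ((b ⊛ inv b) ⊛ (c ⊛ inv c)) ≈⟨ ⊛-congʳ u (⊛-cong (⊛-inverseʳ b b₀≡1) (⊛-inverseʳ c c₀≡1)) ⟩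
  u ⊛ (𝟙 ⊛ 𝟙)                     ≈⟨ ⊛-congʳ u (⊛-identityˡ 𝟙) ⟩
  u ⊛ 𝟙                           ≈⟨ ⊛-identityʳ u ⟩
  u                               ∎
  where
  open ≗-Reasoning
  regroup : ∀ u b b′ c c′ → (u ⊛ (b ⊛ b′)) ⊛ (c ⊛ c′) ≗ u ⊛ ((b ⊛ c′) ⊛ (c ⊛ b′))
  regroup = solve 5 (λ u b b′ c c′ → (u ⊗ (b ⊗ b′)) ⊗ (c ⊗ c′) ⊜ u ⊗ ((b ⊗ c′) ⊗ (c ⊗ b′)))
                  (λ _ → refl)

-- Agreement up to a given degree

infix 4 _≈[_]_ q^_∣_

_≈[_]_ : PS → ℕ → PS → Set
f ≈[ d ] g = ∀ i → i < d → f i ≡ g i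

q^_∣_ : ℕ → PS → Set
q^ d ∣ f = f ≈[ d ] 𝟘

≈-refl : ∀ f {d} → f ≈[ d ] f
≈-refl f i _ = refl

≈-sym : ∀ {f g d} → f ≈[ d ] g → g ≈[ d ] f
≈-sym e i i<d = sym (e i i<d)

≈-trans : ∀ {f g h d} → f ≈[ d ] g → g ≈[ d ] h → f ≈[ d ] h
≈-trans e e′ i i<d = trans (e i i<d) (e′ i i<d)

≈-weaken : ∀ {f g d d′} → d′ ≤ d → f ≈[ d ] g → f ≈[ d′ ] g
≈-weaken d′≤d e i i<d′ = e i (ℕP.<-≤-trans i<d′ d′≤d)

≗⇒≈ : ∀ {f g d} → f ≗ g → f ≈[ d ] g
≗⇒≈ e i _ = e i

⊛-cong-≈ : ∀ {f f′ g g′ d} → f ≈[ d ] f′ → g ≈[ d ] g′ → f ⊛ g ≈[ d ] f′ ⊛ g′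
⊛-cong-≈ e e′ i i<d = sumTo-cong i (λ l l≤i →
  cong₂ ℤ._*_ (e l (ℕP.≤-<-trans l≤i i<d)) (e′ (i ∸ l) (ℕP.≤-<-trans (ℕP.m∸n≤m i l) i<d)))

q^0∣ : ∀ f → q^ 0 ∣ f
q^0∣ f i ()

∣-⊛ : ∀ {a b f g} → q^ a ∣ f → q^ b ∣ g → q^ (a + b) ∣ f ⊛ g
∣-⊛ {a} {b} {f} {g} a∣f b∣g i i<a+b = sumTo-zero _ i term-zero
  where
  i∸l<b : ∀ {l} → l ≤ i → a ≤ l → i ∸ l < b
  i∸l<b {l} l≤i a≤l = ℕP.+-cancelˡ-< l (i ∸ l) b (begin-strict
    l + (i ∸ l) ≡⟨ ℕP.m+[n∸m]≡n l≤i ⟩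
    i           <⟨ i<a+b ⟩
    a + b       ≤⟨ ℕP.+-monoˡ-≤ b a≤l ⟩
    l + b       ∎)
    where open ℕP.≤-Reasoning

  term-zero : ∀ l → l ≤ i → f l ℤ.* g (i ∸ l) ≡ + 0
  term-zero l l≤i with l <? a
  ... | yes l<a rewrite a∣f l l<a = ℤP.*-zeroˡ (g (i ∸ l))
  ... | no  l≮a rewrite b∣g (i ∸ l) (i∸l<b l≤i (ℕP.≮⇒≥ l≮a)) = ℤP.*-zeroʳ (f l)

q^-∣-q^ : ∀ d → q^ d ∣ qpow d
q^-∣-q^ zero    i ()
q^-∣-q^ (suc d) zero    _          = refl
q^-∣-q^ (suc d) (suc i) (s≤s i<d) = q^-∣-q^ d i i<d

q^0≗𝟙 : qpow 0 ≗ 𝟙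
q^0≗𝟙 zero    = refl
q^0≗𝟙 (suc n) = refl

q^-+ : ∀ a b → qpow a ⊛ qpow b ≗ qpow (a + b)
q^-+ zero    b N       = trans (⊛-congˡ (qpow b) q^0≗𝟙 N) (⊛-identityˡ (qpow b) N)
q^-+ (suc a) b zero    = refl
q^-+ (suc a) b (suc N) = begin
  (qpow (suc a) ⊛ qpow b) (suc N)          ≡⟨ ⊛-suc (qpow (suc a)) (qpow b) N ⟩
  + 0 ℤ.+ (tail (qpow (suc a)) ⊛ qpow b) N ≡⟨ ℤP.+-identityˡ _ ⟩
  (qpow a ⊛ qpow b) N                      ≡⟨ q^-+ a b N ⟩
  qpow (a + b) N                           ∎
  where open ≡-Reasoning

q^-cong : ∀ {a b} → a ≡ b → qpow a ≗ qpow b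
q^-cong refl _ = refl

𝟙-q^_ : ℕ → PS
𝟙-q^ e = 𝟙 ⊖ qpow e

𝟙-q^≈𝟙 : ∀ e → 𝟙-q^ e ≈[ e ] 𝟙
𝟙-q^≈𝟙 e i i<e rewrite q^-∣-q^ e i i<e = ℤP.+-identityʳ (𝟙 i)

module _ (c : ℕ) ⦃ _ : ℕ.NonZero c ⦄ (P X Y : ℕ → PS)
         (X-rec : ∀ s → X s ≗ P s ⊛ X (s + c))
         (Y-rec : ∀ s → Y s ≗ P s ⊛ Y (s + c))
         (X≈Y : ∀ s → X s ≈[ s ] Y s) where

  private
    agree-to : ∀ R s → X s ≈[ s + c * R ] Y s
    agree-to zero s rewrite ℕP.*-zeroʳ c | ℕP.+-identityʳ s = X≈Y s
    agree-to (suc R) s rewrite ℕP.*-suc c R | sym (ℕP.+-assoc s c (c * R)) =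
      ≈-trans (≗⇒≈ (X-rec s))
        (≈-trans (⊛-cong-≈ (≈-refl (P s)) (agree-to R (s + c))) (≗⇒≈ (≗-sym (Y-rec s))))

  contracting-recursion-unique : ∀ s → X s ≗ Y s
  contracting-recursion-unique s N = agree-to (suc N) s N
    (ℕP.<-≤-trans (ℕP.n<1+n N) (ℕP.≤-trans (ℕP.m≤n*m (suc N) c) (ℕP.m≤n+m (c * suc N) s)))

poch-cong : ∀ {a a′ n n′} b → a ≡ a′ → n ≡ n′ → poch a b n ≗ poch a′ b n′
poch-cong b refl refl _ = refl

poch-+ : ∀ a b n r → poch a b (n + r) ≗ poch a b n ⊛ poch (a + b * n) b r
poch-+ a b n zero rewrite ℕP.+-identityʳ n = ≗-sym (⊛-identityʳ (poch a b n))
poch-+ a b n (suc r) rewrite ℕP.+-suc n r = begin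
  poch a b (n + r) ⊛ 𝟙-q^ (a + b * (n + r))
    ≈⟨ ⊛-cong (poch-+ a b n r) (λ i → cong (λ e → (𝟙-q^ e) i) exponent) ⟩
  (poch a b n ⊛ poch (a + b * n) b r) ⊛ 𝟙-q^ (a + b * n + b * r)
    ≈⟨ ⊛-assoc (poch a b n) (poch (a + b * n) b r) (𝟙-q^ (a + b * n + b * r)) ⟩
  poch a b n ⊛ poch (a + b * n) b (suc r) ∎
  where
  open ≗-Reasoning
  exponent : a + b * (n + r) ≡ a + b * n + b * r
  exponent = trans (cong (_+_ a) (ℕP.*-distribˡ-+ b n r)) (sym (ℕP.+-assoc a (b * n) (b * r)))

poch-1 : ∀ a b → poch a b 1 ≗ 𝟙-q^ a
poch-1 a b rewrite ℕP.*-zeroʳ b | ℕP.+-identityʳ a = ⊛-identityˡ (𝟙-q^ a)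

poch≈𝟙 : ∀ a b n → poch a b n ≈[ a ] 𝟙
poch≈𝟙 a b zero    = ≈-refl 𝟙
poch≈𝟙 a b (suc n) = ≈-trans
  (⊛-cong-≈ (poch≈𝟙 a b n) (≈-weaken (ℕP.m≤m+n a (b * n)) (𝟙-q^≈𝟙 (a + b * n))))
  (≗⇒≈ (⊛-identityˡ 𝟙))

poch-normalised : ∀ a b n → 1 ≤ a → Normalised (poch a b n)
poch-normalised a b n 1≤a = poch≈𝟙 a b n 0 1≤a

poch-+≈poch : ∀ a b n r → poch a b (n + r) ≈[ a + b * n ] poch a b n
poch-+≈poch a b n r = ≈-trans (≗⇒≈ (poch-+ a b n r)) (≈-trans
  (⊛-cong-≈ (≈-refl (poch a b n)) (poch≈𝟙 (a + b * n) b r)) (≗⇒≈ (⊛-identityʳ (poch a b n))))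

pochInf≈poch : ∀ {a b} → 1 ≤ a → 1 ≤ b → ∀ {d n} → d ≤ n → pochInf a b ≈[ d ] poch a b n
pochInf≈poch {a} {b} 1≤a 1≤b {d} {n} d≤n i i<d = sym (begin
  poch a b n i                     ≡⟨ cong (λ l → poch a b l i) (ℕP.m+[n∸m]≡n i<n) ⟨
  poch a b (suc i + (n ∸ suc i)) i ≡⟨ poch-+≈poch a b (suc i) (n ∸ suc i) i i<a+b[1+i] ⟩
  poch a b (suc i) i               ∎)
  where
  open ≡-Reasoning
  i<n : i < n
  i<n = ℕP.<-≤-trans i<d d≤n
  i<a+b[1+i] : i < a + b * suc i
  i<a+b[1+i] = ℕP.≤-trans (ℕP.m≤n*m (suc i) b ⦃ ℕ.>-nonZero 1≤b ⦄) (ℕP.m≤n+m (b * suc i) a)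

pochInf-split : ∀ {a b} → 1 ≤ a → 1 ≤ b → ∀ n →
  pochInf a b ≗ poch a b n ⊛ pochInf (a + b * n) b
pochInf-split {a} {b} 1≤a 1≤b n N = begin
  pochInf a b N
    ≡⟨ pochInf≈poch 1≤a 1≤b (ℕP.m≤n+m (suc N) n) N ℕP.≤-refl ⟩
  poch a b (n + suc N) N
    ≡⟨ poch-+ a b n (suc N) N ⟩
  (poch a b n ⊛ poch (a + b * n) b (suc N)) N
    ≡⟨ ⊛-cong-≈ (≈-refl (poch a b n)) tail-truncation N ℕP.≤-refl ⟩
  (poch a b n ⊛ pochInf (a + b * n) b) N ∎
  where
  open ≡-Reasoning
  tail-truncation : poch (a + b * n) b (suc N) ≈[ suc N ] pochInf (a + b * n) b
  tail-truncation = ≈-sym (pochInf≈poch (ℕP.≤-trans 1≤a (ℕP.m≤m+n a (b * n))) 1≤b ℕP.≤-refl)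

pochInf≈𝟙 : ∀ a b → pochInf a b ≈[ a ] 𝟙
pochInf≈𝟙 a b i = poch≈𝟙 a b (suc i) i

pochInf-normalised : ∀ a b → 1 ≤ a → Normalised (pochInf a b)
pochInf-normalised a b 1≤a = pochInf≈𝟙 a b 0 1≤a

pochInf-unfold : ∀ {a b} → 1 ≤ a → 1 ≤ b → pochInf a b ≗ 𝟙-q^ a ⊛ pochInf (a + b) b
pochInf-unfold {a} {b} 1≤a 1≤b N rewrite sym (cong (_+_ a) (ℕP.*-identityʳ b)) =
  trans (pochInf-split 1≤a 1≤b 1 N) (⊛-congˡ (pochInf (a + b * 1) b) (poch-1 a b) N)

Summable : (ℕ → PS) → Set
Summable T = ∀ n → q^ n ∣ T n

sumInf-truncate : ∀ {T} → Summable T → ∀ {N M} → N ≤ M → sumInf T N ≡ sumTo (λ n → T n N) M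
sumInf-truncate {T} summable {N} {M} N≤M =
  sym (sumTo-extend (λ n → T n N) M (λ n N<n → summable n N N<n) N≤M)

sumInf-cong : ∀ {T T′} → (∀ n → T n ≗ T′ n) → sumInf T ≗ sumInf T′
sumInf-cong e N = sumTo-cong N (λ n _ → e n N)

sumInf-⊖ : ∀ T T′ → sumInf (λ n → T n ⊖ T′ n) ≗ sumInf T ⊖ sumInf T′
sumInf-⊖ T T′ N = trans (sumTo-+ (λ n → T n N) (λ n → - T′ n N) N)
  (cong (ℤ._+_ (sumInf T N)) (sumTo-neg (λ n → T′ n N) N))

sumInf-comm : ∀ (A : ℕ → ℕ → PS) →
  sumInf (λ n → sumInf (A n)) ≗ sumInf (λ j → sumInf (λ n → A n j))
sumInf-comm A N = sumTo-comm (λ n j → A n j N) N N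

sumInf-drop-head : ∀ {T} → Summable T → T 0 ≗ 𝟘 → sumInf T ≗ sumInf (T ∘ suc)
sumInf-drop-head {T} summable T₀≗0 N = begin
  sumInf T N                   ≡⟨ sumInf-truncate summable (ℕP.n≤1+n N) ⟩
  sumTo (λ n → T n N) (suc N)  ≡⟨ sumTo-unfoldˡ (λ n → T n N) N ⟩
  T 0 N ℤ.+ sumInf (T ∘ suc) N ≡⟨ cong (ℤ._+ sumInf (T ∘ suc) N) (T₀≗0 N) ⟩
  + 0 ℤ.+ sumInf (T ∘ suc) N   ≡⟨ ℤP.+-identityˡ _ ⟩
  sumInf (T ∘ suc) N           ∎
  where open ≡-Reasoning

⊛-sumInf : ∀ f {T} → Summable T → f ⊛ sumInf T ≗ sumInf (λ n → f ⊛ T n)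
⊛-sumInf f {T} summable N = begin
  (f ⊛ sumInf T) N
    ≡⟨ sumTo-cong N (λ i _ → cong (f i ℤ.*_) (sumInf-truncate summable (ℕP.m∸n≤m N i))) ⟩
  sumTo (λ i → f i ℤ.* sumTo (λ n → T n (N ∸ i)) N) N
    ≡⟨ sumTo-cong N (λ i _ → sumTo-*ˡ (f i) (λ n → T n (N ∸ i)) N) ⟨
  sumTo (λ i → sumTo (λ n → f i ℤ.* T n (N ∸ i)) N) N
    ≡⟨ sumTo-comm (λ i n → f i ℤ.* T n (N ∸ i)) N N ⟩
  sumInf (λ n → f ⊛ T n) N ∎
  where open ≡-Reasoning

-- The q-binomial theorem in base q²

⊖-cong : ∀ {f f′ g g′} → f ≗ f′ → g ≗ g′ → f ⊖ g ≗ f′ ⊖ g′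
⊖-cong e e′ n = cong₂ ℤ._-_ (e n) (e′ n)

𝟙-q^-⊛ : ∀ e f → 𝟙-q^ e ⊛ f ≗ f ⊖ qpow e ⊛ f
𝟙-q^-⊛ e f N = trans (⊛-distribʳ-⊕ f 𝟙 (neg (qpow e)) N) (cong₂ ℤ._+_ (⊛-identityˡ f N)
  (trans (⊛-comm (neg (qpow e)) f N) (trans (⊛-neg f (qpow e) N) (cong -_ (⊛-comm f (qpow e) N)))))

⊛-𝟙-q^-⊛-q^ : ∀ c y x → (c ⊛ 𝟙-q^ y) ⊛ qpow x ≗ c ⊛ qpow x ⊖ c ⊛ qpow (y + x)
⊛-𝟙-q^-⊛-q^ c y x N = begin
  ((c ⊛ 𝟙-q^ y) ⊛ qpow x) N          ≡⟨ ⊛-assoc c (𝟙-q^ y) (qpow x) N ⟩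
  (c ⊛ (𝟙-q^ y ⊛ qpow x)) N          ≡⟨ ⊛-congʳ c (𝟙-q^-⊛ y (qpow x)) N ⟩
  (c ⊛ (qpow x ⊖ qpow y ⊛ qpow x)) N ≡⟨ ⊛-distribˡ-⊕ c (qpow x) (neg (qpow y ⊛ qpow x)) N ⟩
  (c ⊛ qpow x) N ℤ.+ (c ⊛ neg (qpow y ⊛ qpow x)) N
    ≡⟨ cong (ℤ._+_ ((c ⊛ qpow x) N))
            (trans (⊛-neg c (qpow y ⊛ qpow x) N) (cong -_ (⊛-congʳ c (q^-+ y x) N))) ⟩
  (c ⊛ qpow x ⊖ c ⊛ qpow (y + x)) N        ∎
  where open ≡-Reasoning

q^-⊛-⊛-q^ : ∀ x c y → qpow x ⊛ (c ⊛ qpow y) ≗ c ⊛ qpow (x + y)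
q^-⊛-⊛-q^ x c y = ≗-trans (⊛-left-comm (qpow x) c (qpow y)) (⊛-congʳ c (q^-+ x y))

poch∞ : ℕ → PS
poch∞ x = pochInf x 2

qBinomialCoeff : ℕ → ℕ → PS
qBinomialCoeff a j = poch a 2 j ⊛ inv (poch 2 2 j)

qBinomialTerm : ℕ → ℕ → ℕ → PS
qBinomialTerm a s j = qBinomialCoeff a j ⊛ qpow (s * j)

qBinomialSeries : ℕ → ℕ → PS
qBinomialSeries a s = sumInf (qBinomialTerm a s)

qBinomialTerm-summable : ∀ a s → 1 ≤ s → Summable (qBinomialTerm a s)
qBinomialTerm-summable a s 1≤s j = ≈-weaken (ℕP.m≤n*m j s ⦃ ℕ.>-nonZero 1≤s ⦄)
  (∣-⊛ {0} (q^0∣ (qBinomialCoeff a j)) (q^-∣-q^ (s * j)))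

qBinomialCoeff-suc : ∀ a j →
  qBinomialCoeff a (suc j) ⊛ 𝟙-q^ (2 + 2 * j) ≗ qBinomialCoeff a j ⊛ 𝟙-q^ (a + 2 * j)
qBinomialCoeff-suc a j = begin
  ((p ⊛ 𝟙-q^ (a + 2 * j)) ⊛ inv (r ⊛ d)) ⊛ d
    ≈⟨ ⊛-congˡ d (⊛-congʳ (p ⊛ 𝟙-q^ (a + 2 * j)) (inv-⊛ r d r₀≡1 refl)) ⟩
  ((p ⊛ 𝟙-q^ (a + 2 * j)) ⊛ (inv r ⊛ inv d)) ⊛ d
    ≈⟨ regroup p (𝟙-q^ (a + 2 * j)) (inv r) (inv d) d ⟩
  (p ⊛ inv r) ⊛ (𝟙-q^ (a + 2 * j) ⊛ (inv d ⊛ d))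
    ≈⟨ ⊛-congʳ (p ⊛ inv r) (⊛-congʳ (𝟙-q^ (a + 2 * j)) (⊛-inverseˡ d refl)) ⟩
  (p ⊛ inv r) ⊛ (𝟙-q^ (a + 2 * j) ⊛ 𝟙)
    ≈⟨ ⊛-congʳ (p ⊛ inv r) (⊛-identityʳ (𝟙-q^ (a + 2 * j))) ⟩
  (p ⊛ inv r) ⊛ 𝟙-q^ (a + 2 * j) ∎
  where
  open ≗-Reasoning
  p = poch a 2 j
  r = poch 2 2 j
  d = 𝟙-q^ (2 + 2 * j)
  r₀≡1 : Normalised r
  r₀≡1 = poch-normalised 2 2 j (s≤s z≤n)
  regroup : ∀ p′ u v w x → ((p′ ⊛ u) ⊛ (v ⊛ w)) ⊛ x ≗ (p′ ⊛ v) ⊛ (u ⊛ (w ⊛ x))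
  regroup = solve 5 (λ p′ u v w x → ((p′ ⊗ u) ⊗ (v ⊗ w)) ⊗ x ⊜ (p′ ⊗ v) ⊗ (u ⊗ (w ⊗ x)))
                    (λ _ → refl)

⊖-exchange : ∀ f g h k → f ⊖ g ≗ h ⊖ k → f ⊖ h ≗ g ⊖ k
⊖-exchange f g h k e n = begin
  f n ℤ.- h n                     ≡⟨ split (f n) (g n) (h n) ⟩
  (f n ℤ.- g n) ℤ.+ (g n ℤ.- h n) ≡⟨ cong (ℤ._+ (g n ℤ.- h n)) (e n) ⟩
  (h n ℤ.- k n) ℤ.+ (g n ℤ.- h n) ≡⟨ cancel (g n) (h n) (k n) ⟩
  g n ℤ.- k n                     ∎
  where
  open ≡-Reasoning
  split : ∀ x y z → x ℤ.- z ≡ (x ℤ.- y) ℤ.+ (y ℤ.- z)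
  split = solve-∀
  cancel : ∀ y z w → (z ℤ.- w) ℤ.+ (y ℤ.- z) ≡ y ℤ.- w
  cancel = solve-∀

module _ (a s : ℕ) (1≤s : 1 ≤ s) where

  private
    T₁ T₂ : ℕ → PS
    T₁ = qBinomialTerm a s
    T₂ = qBinomialTerm a (s + 2)

    T₁-summable : Summable T₁
    T₁-summable = qBinomialTerm-summable a s 1≤s

    T₂-summable : Summable T₂
    T₂-summable = qBinomialTerm-summable a (s + 2) (ℕP.≤-trans 1≤s (ℕP.m≤m+n s 2))

    T₁-T₂-summable : Summable (λ j → T₁ j ⊖ T₂ j)
    T₁-T₂-summable j i i<j = cong₂ ℤ._-_ (T₁-summable j i i<j) (T₂-summable j i i<j)

    T₁-T₂-head : T₁ 0 ⊖ T₂ 0 ≗ 𝟘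
    T₁-T₂-head N = trans
      (cong (ℤ._- T₂ 0 N) (⊛-congʳ (qBinomialCoeff a 0) (q^-cong zero-exponents) N))
      (ℤP.+-inverseʳ (T₂ 0 N))
      where
      zero-exponents : s * 0 ≡ (s + 2) * 0
      zero-exponents = trans (ℕP.*-zeroʳ s) (sym (ℕP.*-zeroʳ (s + 2)))

    T₁-T₂-suc : ∀ j → T₁ (suc j) ⊖ T₂ (suc j) ≗ qpow s ⊛ T₁ j ⊖ qpow (a + s) ⊛ T₂ j
    T₁-T₂-suc j = begin
      c (suc j) ⊛ qpow (s * suc j) ⊖ c (suc j) ⊛ qpow ((s + 2) * suc j)
        ≈⟨ ⊖-cong (⊛-congʳ (c (suc j)) (q^-cong (ℕP.*-suc s j)))
                  (⊛-congʳ (c (suc j)) (q^-cong (T₂-exponent s j))) ⟩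
      c (suc j) ⊛ qpow x ⊖ c (suc j) ⊛ qpow ((2 + 2 * j) + x)
        ≈⟨ ⊛-𝟙-q^-⊛-q^ (c (suc j)) (2 + 2 * j) x ⟨
      (c (suc j) ⊛ 𝟙-q^ (2 + 2 * j)) ⊛ qpow x
        ≈⟨ ⊛-congˡ (qpow x) (qBinomialCoeff-suc a j) ⟩
      (c j ⊛ 𝟙-q^ (a + 2 * j)) ⊛ qpow x
        ≈⟨ ⊛-𝟙-q^-⊛-q^ (c j) (a + 2 * j) x ⟩
      c j ⊛ qpow x ⊖ c j ⊛ qpow ((a + 2 * j) + x)
        ≈⟨ ⊖-cong (q^-⊛-⊛-q^ s (c j) (s * j))
                  (≗-trans (q^-⊛-⊛-q^ (a + s) (c j) ((s + 2) * j))
                           (⊛-congʳ (c j) (q^-cong (shifted-T₂-exponent a s j)))) ⟨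
      qpow s ⊛ T₁ j ⊖ qpow (a + s) ⊛ T₂ j ∎
      where
      open ≗-Reasoning
      c = qBinomialCoeff a
      x = s + s * j
      T₂-exponent : ∀ s j → (s + 2) * suc j ≡ (2 + 2 * j) + (s + s * j)
      T₂-exponent = ℕS.solve-∀
      shifted-T₂-exponent : ∀ a s j → (a + s) + (s + 2) * j ≡ (a + 2 * j) + (s + s * j)
      shifted-T₂-exponent = ℕS.solve-∀

  qBinomialSeries-recurrence :
    𝟙-q^ s ⊛ qBinomialSeries a s ≗ 𝟙-q^ (a + s) ⊛ qBinomialSeries a (s + 2)
  qBinomialSeries-recurrence = begin
    𝟙-q^ s ⊛ A           ≈⟨ 𝟙-q^-⊛ s A ⟩
    A ⊖ qpow s ⊛ A       ≈⟨ ⊖-exchange A B (qpow s ⊛ A) (qpow (a + s) ⊛ B) A-B ⟩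
    B ⊖ qpow (a + s) ⊛ B ≈⟨ 𝟙-q^-⊛ (a + s) B ⟨
    𝟙-q^ (a + s) ⊛ B     ∎
    where
    open ≗-Reasoning
    A = qBinomialSeries a s
    B = qBinomialSeries a (s + 2)
    A-B : A ⊖ B ≗ qpow s ⊛ A ⊖ qpow (a + s) ⊛ B
    A-B = begin
      A ⊖ B                                              ≈⟨ sumInf-⊖ T₁ T₂ ⟨
      sumInf (λ j → T₁ j ⊖ T₂ j)                         ≈⟨ sumInf-drop-head T₁-T₂-summable T₁-T₂-head ⟩
      sumInf (λ j → T₁ (suc j) ⊖ T₂ (suc j))             ≈⟨ sumInf-cong T₁-T₂-suc ⟩
      sumInf (λ j → qpow s ⊛ T₁ j ⊖ qpow (a + s) ⊛ T₂ j) ≈⟨ sumInf-⊖ _ _ ⟩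
      sumInf (λ j → qpow s ⊛ T₁ j) ⊖ sumInf (λ j → qpow (a + s) ⊛ T₂ j)
        ≈⟨ ⊖-cong (⊛-sumInf (qpow s) T₁-summable) (⊛-sumInf (qpow (a + s)) T₂-summable) ⟨
      qpow s ⊛ A ⊖ qpow (a + s) ⊛ B                      ∎

qBinomialTerm-zero : ∀ a s → qBinomialTerm a s 0 ≗ 𝟙
qBinomialTerm-zero a s = begin
  (𝟙 ⊛ inv 𝟙) ⊛ qpow (s * 0) ≈⟨ ⊛-cong (⊛-identityˡ (inv 𝟙)) (q^-cong (ℕP.*-zeroʳ s)) ⟩
  inv 𝟙 ⊛ qpow 0             ≈⟨ ⊛-cong inv-𝟙 q^0≗𝟙 ⟩
  𝟙 ⊛ 𝟙                      ≈⟨ ⊛-identityˡ 𝟙 ⟩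
  𝟙                          ∎
  where open ≗-Reasoning

qBinomialSeries≈𝟙 : ∀ a s → 1 ≤ s → qBinomialSeries a s ≈[ s ] 𝟙
qBinomialSeries≈𝟙 a s 1≤s i i<s =
  trans (sumTo-extend (λ j → qBinomialTerm a s j i) i higher-terms-vanish z≤n) (qBinomialTerm-zero a s i)
  where
  higher-terms-vanish : ∀ j → 0 < j → qBinomialTerm a s j i ≡ + 0
  higher-terms-vanish j@(suc _) _ = ∣-⊛ {0} (q^0∣ (qBinomialCoeff a j)) (q^-∣-q^ (s * j)) i
    (ℕP.<-≤-trans i<s (ℕP.m≤m*n s j))

q-binomial : ∀ a s → 1 ≤ s → qBinomialSeries a s ⊛ poch∞ s ≗ poch∞ (a + s)
q-binomial a (suc t) _ = contracting-recursion-unique 2 P X Y X-rec Y-rec X≈Y t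
  where
  X Y P : ℕ → PS
  X t = qBinomialSeries a (suc t) ⊛ poch∞ (suc t)
  Y t = poch∞ (a + suc t)
  P t = 𝟙-q^ (a + suc t)

  X-rec : ∀ t → X t ≗ P t ⊛ X (t + 2)
  X-rec t = begin
    S ⊛ poch∞ (suc t)       ≈⟨ ⊛-congʳ S (pochInf-unfold (s≤s z≤n) (s≤s z≤n)) ⟩
    S ⊛ (𝟙-q^ (suc t) ⊛ E′) ≈⟨ ⊛-left-comm S (𝟙-q^ (suc t)) E′ ⟩
    𝟙-q^ (suc t) ⊛ (S ⊛ E′) ≈⟨ ⊛-assoc (𝟙-q^ (suc t)) S E′ ⟨
    (𝟙-q^ (suc t) ⊛ S) ⊛ E′ ≈⟨ ⊛-congˡ E′ (qBinomialSeries-recurrence a (suc t) (s≤s z≤n)) ⟩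
    (P t ⊛ S′) ⊛ E′         ≈⟨ ⊛-assoc (P t) S′ E′ ⟩
    P t ⊛ X (t + 2)         ∎
    where
    open ≗-Reasoning
    S = qBinomialSeries a (suc t)
    S′ = qBinomialSeries a (suc t + 2)
    E′ = poch∞ (suc t + 2)

  Y-rec : ∀ t → Y t ≗ P t ⊛ Y (t + 2)
  Y-rec t = ≗-trans (pochInf-unfold (ℕP.≤-trans (s≤s z≤n) (ℕP.m≤n+m (suc t) a)) (s≤s z≤n))
    (⊛-congʳ (P t) (λ N → cong (λ x → poch∞ x N) (ℕP.+-assoc a (suc t) 2)))

  X≈Y : ∀ t → X t ≈[ t ] Y t
  X≈Y t = ≈-weaken (ℕP.n≤1+n t) (≈-trans
    (≈-trans (⊛-cong-≈ (qBinomialSeries≈𝟙 a (suc t) (s≤s z≤n)) (pochInf≈𝟙 (suc t) 2)) (≗⇒≈ (⊛-identityˡ 𝟙)))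
    (≈-sym (≈-weaken (ℕP.m≤n+m (suc t) a) (pochInf≈𝟙 (a + suc t) 2))))

poch∞-cong : ∀ {x y} → x ≡ y → poch∞ x ≗ poch∞ y
poch∞-cong refl _ = refl

poch∞-normalised : ∀ x → 1 ≤ x → Normalised (poch∞ x)
poch∞-normalised x = pochInf-normalised x 2

qBinomialSeries-ratio : ∀ a s → 1 ≤ s → qBinomialSeries a s ≗ poch∞ (a + s) ⊛ inv (poch∞ s)
qBinomialSeries-ratio a s 1≤s = ⊛≗⇒≗⊛-inv (poch∞-normalised s 1≤s) (q-binomial a s 1≤s)

-- Reduction of the left-hand side to a single sum

ρ : PS
ρ = poch∞ 2 ⊛ inv (poch∞ 1)

ρ-split : ∀ u v →
  ρ ≗ (poch 2 2 u ⊛ inv (poch 1 2 v)) ⊛ (poch∞ (2 + 2 * u) ⊛ inv (poch∞ (1 + 2 * v)))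
ρ-split u v = begin
  poch∞ 2 ⊛ inv (poch∞ 1)     ≈⟨ ⊛-cong (pochInf-split (s≤s z≤n) (s≤s z≤n) u)
                                         (inv-cong (pochInf-split (s≤s z≤n) (s≤s z≤n) v)
                                                   (⊛-normalised p₁ y p₁₀≡1 y₀≡1)) ⟩
  (p₂ ⊛ x) ⊛ inv (p₁ ⊛ y)     ≈⟨ fraction-⊛ p₂ x p₁ y p₁₀≡1 y₀≡1 ⟩
  (p₂ ⊛ inv p₁) ⊛ (x ⊛ inv y) ∎
  where
  open ≗-Reasoning
  p₁ = poch 1 2 v
  p₂ = poch 2 2 u
  x = poch∞ (2 + 2 * u)
  y = poch∞ (1 + 2 * v)
  p₁₀≡1 : Normalised p₁
  p₁₀≡1 = poch-normalised 1 2 v (s≤s z≤n)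
  y₀≡1 : Normalised y
  y₀≡1 = poch∞-normalised (1 + 2 * v) (s≤s z≤n)

poch∞-shift-ratio : ∀ n → poch∞ (2 * n + 2) ⊛ inv (poch∞ (2 * n + 1)) ≗ ρ ⊛ qBinomialCoeff 1 n
poch∞-shift-ratio n = ≗-sym (begin
  ρ ⊛ (p₁ ⊛ inv p₂)
    ≈⟨ ⊛-congˡ (p₁ ⊛ inv p₂) (≗-trans (ρ-split n n) (⊛-comm (p₂ ⊛ inv p₁) (x ⊛ inv y))) ⟩
  ((x ⊛ inv y) ⊛ (p₂ ⊛ inv p₁)) ⊛ (p₁ ⊛ inv p₂)
    ≈⟨ fraction-reciprocal (x ⊛ inv y) p₂ p₁ (poch-normalised 2 2 n (s≤s z≤n)) (poch-normalised 1 2 n (s≤s z≤n)) ⟩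
  x ⊛ inv y
    ≈⟨ ⊛-cong (poch∞-cong (two n)) (λ i → cong (λ e → inv (poch∞ e) i) (one n)) ⟩
  poch∞ (2 * n + 2) ⊛ inv (poch∞ (2 * n + 1)) ∎)
  where
  open ≗-Reasoning
  p₁ = poch 1 2 n
  p₂ = poch 2 2 n
  x = poch∞ (2 + 2 * n)
  y = poch∞ (1 + 2 * n)
  two : ∀ n → 2 + 2 * n ≡ 2 * n + 2
  two = ℕS.solve-∀
  one : ∀ n → 1 + 2 * n ≡ 2 * n + 1
  one = ℕS.solve-∀

ρ-⊛-ratio : ∀ u →
  ρ ⊛ (poch∞ (1 + 2 * suc u) ⊛ inv (poch∞ (2 * suc u))) ≗ poch 2 2 u ⊛ inv (poch 1 2 (suc u))
ρ-⊛-ratio u = begin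
  ρ ⊛ (y ⊛ inv (poch∞ (2 * suc u)))           ≈⟨ ⊛-congʳ ρ (⊛-congʳ y (inv-cong (poch∞-cong (double-suc u)) x₀≡1)) ⟩
  ρ ⊛ (y ⊛ inv x)                             ≈⟨ ⊛-congˡ (y ⊛ inv x) (ρ-split u (suc u)) ⟩
  ((p₂ ⊛ inv p₁) ⊛ (x ⊛ inv y)) ⊛ (y ⊛ inv x) ≈⟨ fraction-reciprocal (p₂ ⊛ inv p₁) x y x₀≡1 y₀≡1 ⟩
  p₂ ⊛ inv p₁                                 ∎
  where
  open ≗-Reasoning
  p₁ = poch 1 2 (suc u)
  p₂ = poch 2 2 u
  x = poch∞ (2 + 2 * u)
  y = poch∞ (1 + 2 * suc u)
  x₀≡1 : Normalised x
  x₀≡1 = poch∞-normalised (2 + 2 * u) (s≤s z≤n)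
  y₀≡1 : Normalised y
  y₀≡1 = poch∞-normalised (1 + 2 * suc u) (s≤s z≤n)
  double-suc : ∀ u → 2 * suc u ≡ 2 + 2 * u
  double-suc = ℕS.solve-∀

module _ (a m′ : ℕ) where

  private
    m : ℕ
    m = suc m′

  lhsTerm : ℕ → PS
  lhsTerm n = (qpow (m * (2 * n + 1)) ⊛ (poch∞ (2 * n + 2) ⊛ inv (poch∞ (2 * n + 1))))
            ⊛ (poch∞ (a + (2 * n + 1)) ⊛ inv (poch∞ (2 * n + 1)))

  singleTerm : ℕ → PS
  singleTerm j = (qBinomialCoeff a j ⊛ qpow (m + j)) ⊛ (poch 2 2 (m′ + j) ⊛ inv (poch 1 2 (m + j)))

  private
    doubleTerm : ℕ → ℕ → PS
    doubleTerm n j = (qpow (m * (2 * n + 1)) ⊛ (ρ ⊛ qBinomialCoeff 1 n)) ⊛ qBinomialTerm a (2 * n + 1) j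

    1≤2n+1 : ∀ n → 1 ≤ 2 * n + 1
    1≤2n+1 n = ℕP.m≤n+m 1 (2 * n)

    lhsTerm-expand : ∀ n → lhsTerm n ≗ sumInf (doubleTerm n)
    lhsTerm-expand n = ≗-trans
      (⊛-cong (⊛-congʳ (qpow (m * (2 * n + 1))) (poch∞-shift-ratio n))
              (≗-sym (qBinomialSeries-ratio a (2 * n + 1) (1≤2n+1 n))))
      (⊛-sumInf (qpow (m * (2 * n + 1)) ⊛ (ρ ⊛ qBinomialCoeff 1 n))
                (qBinomialTerm-summable a (2 * n + 1) (1≤2n+1 n)))

    doubleTerm-regroup : ∀ n j →
      doubleTerm n j ≗ ((qBinomialCoeff a j ⊛ qpow (m + j)) ⊛ ρ) ⊛ qBinomialTerm 1 (2 * (m + j)) n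
    doubleTerm-regroup n j = begin
      (qpow e₁ ⊛ (ρ ⊛ c₁)) ⊛ (cₐ ⊛ qpow e₂)         ≈⟨ regroup₁ (qpow e₁) ρ c₁ cₐ (qpow e₂) ⟩
      ((cₐ ⊛ ρ) ⊛ c₁) ⊛ (qpow e₁ ⊛ qpow e₂)         ≈⟨ ⊛-congʳ ((cₐ ⊛ ρ) ⊛ c₁) exponents ⟩
      ((cₐ ⊛ ρ) ⊛ c₁) ⊛ (qpow M ⊛ qpow (2 * M * n)) ≈⟨ regroup₂ cₐ ρ c₁ (qpow M) (qpow (2 * M * n)) ⟩
      ((cₐ ⊛ qpow M) ⊛ ρ) ⊛ (c₁ ⊛ qpow (2 * M * n)) ∎
      where
      open ≗-Reasoning
      M = m + j
      e₁ = m * (2 * n + 1)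
      e₂ = (2 * n + 1) * j
      c₁ = qBinomialCoeff 1 n
      cₐ = qBinomialCoeff a j
      exponent : ∀ m n j → m * (2 * n + 1) + (2 * n + 1) * j ≡ (m + j) + 2 * (m + j) * n
      exponent = ℕS.solve-∀
      exponents : qpow e₁ ⊛ qpow e₂ ≗ qpow M ⊛ qpow (2 * M * n)
      exponents = ≗-trans (q^-+ e₁ e₂) (≗-trans (q^-cong (exponent m n j)) (≗-sym (q^-+ M (2 * M * n))))
      regroup₁ : ∀ x g c d y → (x ⊛ (g ⊛ c)) ⊛ (d ⊛ y) ≗ ((d ⊛ g) ⊛ c) ⊛ (x ⊛ y)
      regroup₁ = solve 5 (λ x g c d y → (x ⊗ (g ⊗ c)) ⊗ (d ⊗ y) ⊜ ((d ⊗ g) ⊗ c) ⊗ (x ⊗ y))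
                       (λ _ → refl)
      regroup₂ : ∀ d g c x y → ((d ⊛ g) ⊛ c) ⊛ (x ⊛ y) ≗ ((d ⊛ x) ⊛ g) ⊛ (c ⊛ y)
      regroup₂ = solve 5 (λ d g c x y → ((d ⊗ g) ⊗ c) ⊗ (x ⊗ y) ⊜ ((d ⊗ x) ⊗ g) ⊗ (c ⊗ y))
                       (λ _ → refl)

    doubleTerm-sum : ∀ j → sumInf (λ n → doubleTerm n j) ≗ singleTerm j
    doubleTerm-sum j = begin
      sumInf (λ n → doubleTerm n j)
        ≈⟨ sumInf-cong (λ n → doubleTerm-regroup n j) ⟩
      sumInf (λ n → (cq ⊛ ρ) ⊛ qBinomialTerm 1 (2 * M) n)
        ≈⟨ ⊛-sumInf (cq ⊛ ρ) (qBinomialTerm-summable 1 (2 * M) (s≤s z≤n)) ⟨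
      (cq ⊛ ρ) ⊛ qBinomialSeries 1 (2 * M)
        ≈⟨ ⊛-congʳ (cq ⊛ ρ) (qBinomialSeries-ratio 1 (2 * M) (s≤s z≤n)) ⟩
      (cq ⊛ ρ) ⊛ (poch∞ (1 + 2 * M) ⊛ inv (poch∞ (2 * M)))
        ≈⟨ ⊛-assoc cq ρ (poch∞ (1 + 2 * M) ⊛ inv (poch∞ (2 * M))) ⟩
      cq ⊛ (ρ ⊛ (poch∞ (1 + 2 * M) ⊛ inv (poch∞ (2 * M))))
        ≈⟨ ⊛-congʳ cq (ρ-⊛-ratio (m′ + j)) ⟩
      singleTerm j ∎
      where
      open ≗-Reasoning
      M = m + j
      cq = qBinomialCoeff a j ⊛ qpow M

  lhs-single-sum : sumInf lhsTerm ≗ sumInf singleTerm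
  lhs-single-sum = ≗-trans (sumInf-cong lhsTerm-expand)
    (≗-trans (sumInf-comm doubleTerm) (sumInf-cong doubleTerm-sum))

LHS-as-lhsTerm : ∀ k′ m′ → LHS (suc k′) (suc m′) ≗ sumInf (lhsTerm (1 + 2 * k′) m′)
LHS-as-lhsTerm k′ m′ = sumInf-cong λ n →
  ≗-trans (regroup (qpow (suc m′ * (2 * n + 1))) (poch∞ (2 * n + 2)) (poch∞ (2 * n + 2 * suc k′))
                   (inv (poch∞ (2 * n + 1))))
          (⊛-congʳ (qpow (suc m′ * (2 * n + 1)) ⊛ (poch∞ (2 * n + 2) ⊛ inv (poch∞ (2 * n + 1))))
            (⊛-congˡ (inv (poch∞ (2 * n + 1))) (poch∞-cong (exponent k′ n))))
  where
  regroup : ∀ q x z y → (((q ⊛ x) ⊛ z) ⊛ y) ⊛ y ≗ (q ⊛ (x ⊛ y)) ⊛ (z ⊛ y)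
  regroup = solve 4 (λ q x z y → (((q ⊗ x) ⊗ z) ⊗ y) ⊗ y ⊜ (q ⊗ (x ⊗ y)) ⊗ (z ⊗ y)) (λ _ → refl)
  exponent : ∀ k′ n → 2 * n + 2 * suc k′ ≡ (1 + 2 * k′) + (2 * n + 1)
  exponent = ℕS.solve-∀

singleTerm-simplify : ∀ a m′ j → singleTerm a m′ j ≗
  (poch a 2 j ⊛ ((qpow (suc m′) ⊛ qpow j) ⊛ poch (2 * j + 2) 2 m′)) ⊛ inv (poch 1 2 (suc m′ + j))
singleTerm-simplify a m′ j = begin
  ((pₐ ⊛ inv B) ⊛ qpow M) ⊛ (poch 2 2 (m′ + j) ⊛ inv p₁)
    ≈⟨ ⊛-congʳ ((pₐ ⊛ inv B) ⊛ qpow M) (⊛-congˡ (inv p₁) B-factor) ⟩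
  ((pₐ ⊛ inv B) ⊛ qpow M) ⊛ ((B ⊛ C) ⊛ inv p₁)
    ≈⟨ regroup pₐ (inv B) (qpow M) B C (inv p₁) ⟩
  (B ⊛ inv B) ⊛ ((pₐ ⊛ (qpow M ⊛ C)) ⊛ inv p₁)
    ≈⟨ ⊛-congˡ ((pₐ ⊛ (qpow M ⊛ C)) ⊛ inv p₁) (⊛-inverseʳ B (poch-normalised 2 2 j (s≤s z≤n))) ⟩
  𝟙 ⊛ ((pₐ ⊛ (qpow M ⊛ C)) ⊛ inv p₁)
    ≈⟨ ⊛-identityˡ _ ⟩
  (pₐ ⊛ (qpow M ⊛ C)) ⊛ inv p₁
    ≈⟨ ⊛-congˡ (inv p₁) (⊛-congʳ pₐ (⊛-congˡ C (≗-sym (q^-+ (suc m′) j)))) ⟩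
  (pₐ ⊛ ((qpow (suc m′) ⊛ qpow j) ⊛ C)) ⊛ inv p₁ ∎
  where
  open ≗-Reasoning
  M = suc m′ + j
  pₐ = poch a 2 j
  B = poch 2 2 j
  C = poch (2 * j + 2) 2 m′
  p₁ = poch 1 2 M
  B-factor : poch 2 2 (m′ + j) ≗ B ⊛ C
  B-factor = ≗-trans (poch-cong 2 refl (ℕP.+-comm m′ j))
    (≗-trans (poch-+ 2 2 j m′) (⊛-congʳ B (poch-cong {n = m′} 2 (ℕP.+-comm 2 (2 * j)) refl)))
  regroup : ∀ p b′ q b c d → ((p ⊛ b′) ⊛ q) ⊛ ((b ⊛ c) ⊛ d) ≗ (b ⊛ b′) ⊛ ((p ⊛ (q ⊛ c)) ⊛ d)
  regroup = solve 6 (λ p b′ q b c d → ((p ⊗ b′) ⊗ q) ⊗ ((b ⊗ c) ⊗ d) ⊜ (b ⊗ b′) ⊗ ((p ⊗ (q ⊗ c)) ⊗ d))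
                  (λ _ → refl)

-- The two cases of the theorem

q^-⊛-summable : ∀ (X Y : ℕ → PS) → Summable (λ j → qpow j ⊛ X j ⊛ Y j)
q^-⊛-summable X Y j = subst (λ d → q^ d ∣ qpow j ⊛ X j ⊛ Y j) (trans (ℕP.+-identityʳ _) (ℕP.+-identityʳ j))
  (∣-⊛ {j + 0} {0} (∣-⊛ {j} {0} (q^-∣-q^ j) (q^0∣ (X j))) (q^0∣ (Y j)))

module _ (k′ r : ℕ) where

  private
    k m a : ℕ
    k = suc k′
    m = suc (k′ + r)
    a = 1 + 2 * k′

    P : PS
    P = poch 1 2 k′

    rhsTerm : ℕ → PS
    rhsTerm j = qpow j ⊛ poch (2 * j + 2) 2 (m ∸ 1) ⊛ inv (poch (2 * j + 2 * k ∸ 1) 2 (m ∸ k + 1))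

    singleTerm≗rhsTerm : ∀ j → singleTerm a (k′ + r) j ≗ (qpow m ⊛ inv P) ⊛ rhsTerm j
    singleTerm≗rhsTerm j = begin
      singleTerm a (k′ + r) j           ≈⟨ singleTerm-simplify a (k′ + r) j ⟩
      (pₐ ⊛ X) ⊛ inv (poch 1 2 (m + j)) ≈⟨ ⊛-congʳ (pₐ ⊛ X) (inv-cong p₁-factor (⊛-normalised pₐ (P ⊛ D) pₐ₀≡1 PD₀≡1)) ⟩
      (pₐ ⊛ X) ⊛ inv (pₐ ⊛ (P ⊛ D))     ≈⟨ fraction-cancelˡ pₐ X (P ⊛ D) pₐ₀≡1 PD₀≡1 ⟩
      X ⊛ inv (P ⊛ D)                   ≈⟨ ⊛-congˡ (inv (P ⊛ D)) (⊛-assoc (qpow m) (qpow j) C) ⟩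
      (qpow m ⊛ (qpow j ⊛ C)) ⊛ inv (P ⊛ D)
        ≈⟨ fraction-⊛ (qpow m) (qpow j ⊛ C) P D P₀≡1 D₀≡1 ⟩
      (qpow m ⊛ inv P) ⊛ ((qpow j ⊛ C) ⊛ inv D)
        ≈⟨ ⊛-congʳ (qpow m ⊛ inv P) (⊛-congʳ (qpow j ⊛ C) (inv-cong (poch-cong 2 D-base D-length) D₀≡1)) ⟨
      (qpow m ⊛ inv P) ⊛ rhsTerm j       ∎
      where
      open ≗-Reasoning
      pₐ = poch a 2 j
      C = poch (2 * j + 2) 2 (k′ + r)
      D = poch (a + 2 * j) 2 (suc r)
      X = (qpow m ⊛ qpow j) ⊛ C
      P₀≡1 : Normalised P
      P₀≡1 = poch-normalised 1 2 k′ (s≤s z≤n)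
      D₀≡1 : Normalised D
      D₀≡1 = poch-normalised (a + 2 * j) 2 (suc r) (s≤s z≤n)
      pₐ₀≡1 : Normalised pₐ
      pₐ₀≡1 = poch-normalised a 2 j (s≤s z≤n)
      PD₀≡1 : Normalised (P ⊛ D)
      PD₀≡1 = ⊛-normalised P D P₀≡1 D₀≡1
      length : ∀ k′ r j → suc (k′ + r) + j ≡ k′ + (j + suc r)
      length = ℕS.solve-∀
      p₁-factor : poch 1 2 (m + j) ≗ pₐ ⊛ (P ⊛ D)
      p₁-factor = begin
        poch 1 2 (m + j)            ≈⟨ poch-cong 2 refl (length k′ r j) ⟩
        poch 1 2 (k′ + (j + suc r)) ≈⟨ poch-+ 1 2 k′ (j + suc r) ⟩
        P ⊛ poch a 2 (j + suc r)    ≈⟨ ⊛-congʳ P (poch-+ a 2 j (suc r)) ⟩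
        P ⊛ (pₐ ⊛ D)                ≈⟨ ⊛-left-comm P pₐ D ⟩
        pₐ ⊛ (P ⊛ D)                ∎
      base : ∀ k′ j → 2 * j + 2 * suc k′ ≡ suc ((1 + 2 * k′) + 2 * j)
      base = ℕS.solve-∀
      D-base : 2 * j + 2 * k ∸ 1 ≡ a + 2 * j
      D-base = cong (_∸ 1) (base k′ j)
      D-length : m ∸ k + 1 ≡ suc r
      D-length = trans (cong (_+ 1) (ℕP.m+n∸m≡n k′ r)) (ℕP.+-comm r 1)

  LHS≗RHS≥ : LHS k m ≗ RHS≥ k m
  LHS≗RHS≥ = begin
    LHS k m                                     ≈⟨ LHS-as-lhsTerm k′ (k′ + r) ⟩
    sumInf (lhsTerm a (k′ + r))                 ≈⟨ lhs-single-sum a (k′ + r) ⟩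
    sumInf (singleTerm a (k′ + r))              ≈⟨ sumInf-cong singleTerm≗rhsTerm ⟩
    sumInf (λ j → (qpow m ⊛ inv P) ⊛ rhsTerm j) ≈⟨ ⊛-sumInf (qpow m ⊛ inv P) (q^-⊛-summable
        (λ j → poch (2 * j + 2) 2 (m ∸ 1)) (λ j → inv (poch (2 * j + 2 * k ∸ 1) 2 (m ∸ k + 1)))) ⟨
    RHS≥ k m                                    ∎
    where open ≗-Reasoning

module _ (m′ r : ℕ) where

  private
    k′ k m a : ℕ
    k′ = suc (m′ + r)
    k = suc k′
    m = suc m′
    a = 1 + 2 * k′

    P : PS
    P = poch 1 2 k′

    rhsTerm : ℕ → PS
    rhsTerm j = qpow j ⊛ poch (2 * j + 2) 2 (m ∸ 1) ⊛ poch (2 * j + 2 * m + 1) 2 (k ∸ m ∸ 1)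

    singleTerm≗rhsTerm : ∀ j → singleTerm a m′ j ≗ (qpow m ⊛ inv P) ⊛ rhsTerm j
    singleTerm≗rhsTerm j = begin
      singleTerm a m′ j ≈⟨ singleTerm-simplify a m′ j ⟩
      (pₐ ⊛ X) ⊛ inv p₁ ≈⟨ cross-multiply (pₐ ⊛ X) (X ⊛ H) p₁ P (poch-normalised 1 2 (m + j) (s≤s z≤n))
                                                           (poch-normalised 1 2 k′ (s≤s z≤n)) cross ⟩
      (X ⊛ H) ⊛ inv P   ≈⟨ regroup (qpow m) (qpow j) C H (inv P) ⟩
      (qpow m ⊛ inv P) ⊛ ((qpow j ⊛ C) ⊛ H)
        ≈⟨ ⊛-congʳ (qpow m ⊛ inv P) (⊛-congʳ (qpow j ⊛ C) (poch-cong 2 H-base H-length)) ⟨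
      (qpow m ⊛ inv P) ⊛ rhsTerm j       ∎
      where
      open ≗-Reasoning
      pₐ = poch a 2 j
      p₁ = poch 1 2 (m + j)
      C = poch (2 * j + 2) 2 m′
      H = poch (1 + 2 * (m + j)) 2 r
      X = (qpow m ⊛ qpow j) ⊛ C
      length : ∀ m′ r j → suc (m′ + r) + j ≡ (suc m′ + j) + r
      length = ℕS.solve-∀
      P⊛pₐ : P ⊛ pₐ ≗ p₁ ⊛ H
      P⊛pₐ = begin
        P ⊛ pₐ                 ≈⟨ poch-+ 1 2 k′ j ⟨
        poch 1 2 (k′ + j)      ≈⟨ poch-cong 2 refl (length m′ r j) ⟩
        poch 1 2 ((m + j) + r) ≈⟨ poch-+ 1 2 (m + j) r ⟩
        p₁ ⊛ H                 ∎
      cross : (pₐ ⊛ X) ⊛ P ≗ (X ⊛ H) ⊛ p₁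
      cross = begin
        (pₐ ⊛ X) ⊛ P ≈⟨ solve 3 (λ p x q → (p ⊗ x) ⊗ q ⊜ x ⊗ (q ⊗ p)) (λ _ → refl) pₐ X P ⟩
        X ⊛ (P ⊛ pₐ) ≈⟨ ⊛-congʳ X P⊛pₐ ⟩
        X ⊛ (p₁ ⊛ H) ≈⟨ solve 3 (λ x p h → x ⊗ (p ⊗ h) ⊜ (x ⊗ h) ⊗ p) (λ _ → refl) X p₁ H ⟩
        (X ⊛ H) ⊛ p₁ ∎
      regroup : ∀ q q′ c h i → (((q ⊛ q′) ⊛ c) ⊛ h) ⊛ i ≗ (q ⊛ i) ⊛ ((q′ ⊛ c) ⊛ h)
      regroup = solve 5 (λ q q′ c h i → (((q ⊗ q′) ⊗ c) ⊗ h) ⊗ i ⊜ (q ⊗ i) ⊗ ((q′ ⊗ c) ⊗ h))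
                      (λ _ → refl)
      base : ∀ m′ j → 2 * j + 2 * suc m′ + 1 ≡ 1 + 2 * (suc m′ + j)
      base = ℕS.solve-∀
      H-base : 2 * j + 2 * m + 1 ≡ 1 + 2 * (m + j)
      H-base = base m′ j
      H-length : k ∸ m ∸ 1 ≡ r
      H-length = length-difference m′
        where
        length-difference : ∀ m′ → suc (m′ + r) ∸ m′ ∸ 1 ≡ r
        length-difference zero     = refl
        length-difference (suc m′) = length-difference m′

  LHS≗RHS< : LHS k m ≗ RHS< k m
  LHS≗RHS< = begin
    LHS k m                                     ≈⟨ LHS-as-lhsTerm k′ m′ ⟩
    sumInf (lhsTerm a m′)                       ≈⟨ lhs-single-sum a m′ ⟩
    sumInf (singleTerm a m′)                    ≈⟨ sumInf-cong singleTerm≗rhsTerm ⟩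
    sumInf (λ j → (qpow m ⊛ inv P) ⊛ rhsTerm j) ≈⟨ ⊛-sumInf (qpow m ⊛ inv P) (q^-⊛-summable
        (λ j → poch (2 * j + 2) 2 (m ∸ 1)) (λ j → poch (2 * j + 2 * m + 1) 2 (k ∸ m ∸ 1))) ⟨
    RHS< k m                                    ∎
    where open ≗-Reasoning

theorem2p2 : (k m : ℕ) → 1 ≤ k → 1 ≤ m →
    ((k ≤ m → (n : ℕ) → C′ k m n ≡ RHS≥ k m n) ×
     (m < k → (n : ℕ) → C′ k m n ≡ RHS< k m n))
theorem2p2 (suc k′) (suc m′) _ _ = at-least , below
  where
  at-least : suc k′ ≤ suc m′ → ∀ n → C′ (suc k′) (suc m′) n ≡ RHS≥ (suc k′) (suc m′) n
  at-least k≤m with r , refl ← ℕP.m≤n⇒∃[o]m+o≡n k≤m = LHS≗RHS≥ k′ r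

  below : suc m′ < suc k′ → ∀ n → C′ (suc k′) (suc m′) n ≡ RHS< (suc k′) (suc m′) n
  below (s≤s m<k) with r , refl ← ℕP.m≤n⇒∃[o]m+o≡n m<k = LHS≗RHS< m′ r
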